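{- Let $f\in\widetilde{M}$ be of depth $r$. Then $\hat D f$ is of depth $r+1$.
   Context: Let $P=1-24\sum_{n\ge1}\sigma_1(n)q^n$, $Q=1+240\sum_{n\ge1}\sigma_3(n)q^n$, $R=1-504\sum_{n\ge1}\sigma_5(n)q^n$ be the Eisenstein series of weights $2,4,6$. The algebra of quasimodular forms is $\widetilde{M}=\mathbb{Q}[P,Q,R]$ ($P,Q,R$ algebraically independent); the depth of a nonzero $f\in\widetilde M$ is its degree as a polynomial in $P$. Let $D=q\frac{d}{dq}$ (which preserves $\widetilde M$, with $D(P)=\frac{P^2-Q}{12}$, $D(Q)=\frac{PQ-R}{3}$, $D(R)=\frac{PR-Q^2}{2}$) and $\hat D=D-\frac{P}{24}$, i.e. $\hat Df=Df-\frac{1}{24}Pf$. -}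

module Defs where

open import Data.Nat as ℕ using (ℕ; zero; suc; _<_; _∸_)
open import Data.Integer using (+_; -[1+_])
open import Data.Rational using (ℚ; _+_; _*_; -_; 0ℚ; 1ℚ; _/_)
open import Data.List using (List; []; _∷_; map; concatMap; _++_)
open import Data.Product using (∃; ∃-syntax; _×_; _,_)
open import Relation.Binary.PropositionalEquality using (_≡_; _≢_)
open import Relation.Nullary using (yes; no)

record Term : Set where
  constructor term
  field
    coef : ℚ
    eP eQ eR : ℕ

-- An element of  ℚ[P,Q,R]  (P,Q,R independent indeterminates), represented
-- as a finite formal sum of terms.  Two representations denote the same
-- quasimodular form iff all their coefficients (see `coeff`) agree.
Poly : Set
Poly = List Term

coeff : Poly → ℕ → ℕ → ℕ → ℚ
coeff [] a b c = 0ℚ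
coeff (term x i j k ∷ f) a b c with i ℕ.≟ a | j ℕ.≟ b | k ℕ.≟ c
... | yes _ | yes _ | yes _ = x + coeff f a b c
... | _     | _     | _     = coeff f a b c

_⊕_ : Poly → Poly → Poly
f ⊕ g = f ++ g

scale : ℚ → Poly → Poly
scale y = map (λ { (term x i j k) → term (y * x) i j k })

_⊖_ : Poly → Poly → Poly
f ⊖ g = f ⊕ scale (- 1ℚ) g

mulTerm : Term → Term → Term
mulTerm (term x i j k) (term y i' j' k') = term (x * y) (i ℕ.+ i') (j ℕ.+ j') (k ℕ.+ k')

_⊗_ : Poly → Poly → Poly
f ⊗ g = concatMap (λ s → map (mulTerm s) g) f

mono : ℕ → ℕ → ℕ → Poly
mono a b c = term 1ℚ a b c ∷ []

-- the Eisenstein series as generators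
P Q R : Poly
P = mono 1 0 0
Q = mono 0 1 0
R = mono 0 0 1

DP DQ DR : Poly
DP = scale (+ 1 / 12) ((P ⊗ P) ⊖ Q)
DQ = scale (+ 1 / 3) ((P ⊗ Q) ⊖ R)
DR = scale (+ 1 / 2) ((P ⊗ R) ⊖ (Q ⊗ Q))

DTerm : Term → Poly
DTerm (term x a b c) =
  scale (x * (+ a / 1)) (mono (a ∸ 1) b c ⊗ DP) ⊕
  (scale (x * (+ b / 1)) (mono a (b ∸ 1) c ⊗ DQ) ⊕
   scale (x * (+ c / 1)) (mono a b (c ∸ 1) ⊗ DR))

-- D = q d/dq, extended additively
D : Poly → Poly
D f = concatMap DTerm f

Dhat : Poly → Poly
Dhat f = D f ⊖ scale (+ 1 / 24) (P ⊗ f)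

-- f is nonzero of depth r: its degree as a polynomial in P is r
Depth : Poly → ℕ → Set
Depth f r = (∃[ j ] ∃[ k ] coeff f r j k ≢ 0ℚ)
          × (∀ i j k → r < i → coeff f i j k ≡ 0ℚ)

{-# OPTIONS --safe #-}
-- Write D(P^i Q^j R^k) = (i/12 + j/3 + k/2) P^(i+1) Q^j R^k - (i/12) P^(i-1) Q^(j+1) R^k
-- - (j/3) P^i Q^(j-1) R^(k+1) - (k/2) P^i Q^(j+2) R^(k-1).  Only the first part raises the
-- power of P.  Hence if f has depth r, then for a ≥ r the coefficient of P^(a+1) Q^b R^c in
-- D̂ f is (a/12 + b/3 + c/2 - 1/24) times the coefficient of P^a Q^b R^c in f, and this
-- factor never vanishes because 24 times it is the odd integer 2a + 8b + 12c - 1.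
-- Taking a = r gives a nonzero coefficient of P^(r+1); taking a > r shows that nothing lies above it.
module Submission where

open import Defs
open import Data.Nat as ℕ using (ℕ; zero; suc; _∸_; _≤_; _<_; s≤s; z≤n)
import Data.Nat.Properties as ℕP
import Data.Nat.Coprimality as Coprimality
open import Data.Integer as ℤ using (+_)
import Data.Integer.Properties as ℤP
open import Data.Rational as ℚ using (ℚ; mkℚ; _+_; _*_; -_; _-_; 0ℚ; 1ℚ; _/_; _≟_; 1/_)
import Data.Rational.Properties as ℚP
open import Data.List using (_∷_; []; _++_; foldr; map)
open import Data.List.Properties using (++-identityʳ)
open import Data.Product using (_,_; proj₁)
open import Level using (0ℓ)
open import Relation.Nullary using (yes; no; contradiction)
open import Function using (_∘_)
open import Relation.Nullary.Decidable.Core using (dec⇒maybe)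
open import Relation.Binary.PropositionalEquality
import Tactic.RingSolver as RingSolver
import Tactic.RingSolver.Core.AlmostCommutativeRing as ACR

ℚ-ring : ACR.AlmostCommutativeRing 0ℓ 0ℓ
ℚ-ring = ACR.fromCommutativeRing ℚP.+-*-commutativeRing (λ x → dec⇒maybe (0ℚ ≟ x))

x*[0*y]≡0 : ∀ x y → x * (0ℚ * y) ≡ 0ℚ
x*[0*y]≡0 x y = trans (cong (x *_) (ℚP.*-zeroˡ y)) (ℚP.*-zeroʳ x)

x*[-y]*z≡-[x*y*z] : ∀ x y z → x * (- y) * z ≡ - (x * y * z)
x*[-y]*z≡-[x*y*z] = RingSolver.solve-∀ ℚ-ring

w≢0∧w*x≡0⇒x≡0 : ∀ {w x} → w ≢ 0ℚ → w * x ≡ 0ℚ → x ≡ 0ℚ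
w≢0∧w*x≡0⇒x≡0 {w} {x} w≢0 w*x≡0 = begin
  x                ≡⟨ ℚP.*-identityˡ x ⟨
  1ℚ * x           ≡⟨ cong (_* x) (ℚP.*-inverseˡ w) ⟨
  (1/ w) * w * x   ≡⟨ ℚP.*-assoc (1/ w) w x ⟩
  (1/ w) * (w * x) ≡⟨ cong ((1/ w) *_) w*x≡0 ⟩
  (1/ w) * 0ℚ      ≡⟨ ℚP.*-zeroʳ (1/ w) ⟩
  0ℚ               ∎
  where
  open ≡-Reasoning
  instance
    w-nonZero : ℚ.NonZero w
    w-nonZero = ℚ.≢-nonZero w≢0

ι : ℕ → ℚ
ι n = + n / 1

ι≡mkℚ : ∀ n → ι n ≡ mkℚ (+ n) 0 (Coprimality.sym (Coprimality.1-coprimeTo n))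
ι≡mkℚ n = ℚP.normalize-coprime (Coprimality.sym (Coprimality.1-coprimeTo n))

ι-homo-+ : ∀ m n → ι (m ℕ.+ n) ≡ ι m + ι n
ι-homo-+ m n rewrite ι≡mkℚ m | ι≡mkℚ n =
  cong (_/ 1) (cong₂ ℤ._+_ (sym (ℤP.*-identityʳ (+ m))) (sym (ℤP.*-identityʳ (+ n))))

ι-homo-* : ∀ m n → ι (m ℕ.* n) ≡ ι m * ι n
ι-homo-* m n rewrite ι≡mkℚ m | ι≡mkℚ n = cong (_/ 1) (ℤP.pos-* m n)

ι-injective : ∀ {m n} → ι m ≡ ι n → m ≡ n
ι-injective {m} {n} ιm≡ιn =
  ℤP.+-injective (proj₁ (ℚP.mkℚ-injective (trans (sym (ι≡mkℚ m)) (trans ιm≡ιn (ι≡mkℚ n)))))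

δ : ℕ → ℕ → ℚ
δ zero    zero    = 1ℚ
δ zero    (suc _) = 0ℚ
δ (suc _) zero    = 0ℚ
δ (suc m) (suc n) = δ m n

δ-refl : ∀ n → δ n n ≡ 1ℚ
δ-refl zero    = refl
δ-refl (suc n) = δ-refl n

δ-≢ : ∀ {m n} → m ≢ n → δ m n ≡ 0ℚ
δ-≢ {zero}  {zero}  m≢n = contradiction refl m≢n
δ-≢ {zero}  {suc n} m≢n = refl
δ-≢ {suc m} {zero}  m≢n = refl
δ-≢ {suc m} {suc n} m≢n = δ-≢ (m≢n ∘ cong suc)

δ-weight : ∀ m n → δ m n * ι m ≡ δ m n * ι n
δ-weight m n with m ℕ.≟ n
... | yes refl = refl
... | no m≢n rewrite δ-≢ m≢n = trans (ℚP.*-zeroˡ (ι m)) (sym (ℚP.*-zeroˡ (ι n)))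

-- The exponent n ∸ 1 is junk when n = 0, but then the weight ι 0 = 0ℚ kills it.
δ-pred-weight : ∀ n m → δ (suc (n ∸ 1)) m * ι n ≡ δ n m * ι m
δ-pred-weight zero    zero    = refl
δ-pred-weight zero    (suc m) = trans (ℚP.*-zeroʳ (δ 0 m)) (sym (ℚP.*-zeroˡ (ι (suc m))))
δ-pred-weight (suc n) m       = δ-weight (suc n) m

Coef : Set
Coef = ℕ → ℕ → ℕ → ℚ

termCoeff : Term → Coef
termCoeff (term y i j k) a b c = δ i a * (δ j b * (δ k c * y))

coeff-∷ : ∀ t f a b c → coeff (t ∷ f) a b c ≡ termCoeff t a b c + coeff f a b c
coeff-∷ (term y i j k) f a b c with i ℕ.≟ a | j ℕ.≟ b | k ℕ.≟ c
... | yes refl | yes refl | yes refl rewrite δ-refl i | δ-refl j | δ-refl k = diagonal y (coeff f i j k)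
  where
  diagonal : ∀ y F → y + F ≡ 1ℚ * (1ℚ * (1ℚ * y)) + F
  diagonal = RingSolver.solve-∀ ℚ-ring
... | yes refl | yes refl | no k≢c rewrite δ-≢ k≢c = offR (δ i i) (δ j j) y (coeff f i j c)
  where
  offR : ∀ A B y F → F ≡ A * (B * (0ℚ * y)) + F
  offR = RingSolver.solve-∀ ℚ-ring
... | yes refl | no j≢b | _ rewrite δ-≢ j≢b = offQ (δ i i) (δ k c * y) (coeff f i b c)
  where
  offQ : ∀ A Y F → F ≡ A * (0ℚ * Y) + F
  offQ = RingSolver.solve-∀ ℚ-ring
... | no i≢a | _ | _ rewrite δ-≢ i≢a = offP (δ j b * (δ k c * y)) (coeff f a b c)
  where
  offP : ∀ Y F → F ≡ 0ℚ * Y + F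
  offP = RingSolver.solve-∀ ℚ-ring

coeff-++ : ∀ f g a b c → coeff (f ++ g) a b c ≡ coeff f a b c + coeff g a b c
coeff-++ []      g a b c = sym (ℚP.+-identityˡ (coeff g a b c))
coeff-++ (t ∷ f) g a b c = begin
  coeff (t ∷ f ++ g) a b c                            ≡⟨ coeff-∷ t (f ++ g) a b c ⟩
  termCoeff t a b c + coeff (f ++ g) a b c            ≡⟨ cong (λ s → termCoeff t a b c + s) (coeff-++ f g a b c) ⟩
  termCoeff t a b c + (coeff f a b c + coeff g a b c) ≡⟨ ℚP.+-assoc (termCoeff t a b c) _ _ ⟨
  termCoeff t a b c + coeff f a b c + coeff g a b c   ≡⟨ cong (_+ coeff g a b c) (coeff-∷ t f a b c) ⟨
  coeff (t ∷ f) a b c + coeff g a b c                 ∎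
  where open ≡-Reasoning

termCoeff-scale : ∀ y x i j k a b c → termCoeff (term (y * x) i j k) a b c ≡ y * termCoeff (term x i j k) a b c
termCoeff-scale y x i j k a b c = pull-out (δ i a) (δ j b) (δ k c) y x
  where
  pull-out : ∀ A B C y x → A * (B * (C * (y * x))) ≡ y * (A * (B * (C * x)))
  pull-out = RingSolver.solve-∀ ℚ-ring

coeff-scale : ∀ y f a b c → coeff (scale y f) a b c ≡ y * coeff f a b c
coeff-scale y []                     a b c = sym (ℚP.*-zeroʳ y)
coeff-scale y (t@(term x i j k) ∷ f) a b c = begin
  coeff (term (y * x) i j k ∷ scale y f) a b c                   ≡⟨ coeff-∷ (term (y * x) i j k) (scale y f) a b c ⟩
  termCoeff (term (y * x) i j k) a b c + coeff (scale y f) a b c ≡⟨ cong₂ _+_ (termCoeff-scale y x i j k a b c) (coeff-scale y f a b c) ⟩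
  y * termCoeff t a b c + y * coeff f a b c                      ≡⟨ ℚP.*-distribˡ-+ y _ _ ⟨
  y * (termCoeff t a b c + coeff f a b c)                        ≡⟨ cong (y *_) (coeff-∷ t f a b c) ⟨
  y * coeff (t ∷ f) a b c                                        ∎
  where open ≡-Reasoning

coeff-P⊗ : ∀ f a b c → coeff (P ⊗ f) (suc a) b c ≡ coeff f a b c
coeff-P⊗ f a b c = trans (cong (λ g → coeff g (suc a) b c) (++-identityʳ (map (mulTerm (term 1ℚ 1 0 0)) f))) (shift f)
  where
  open ≡-Reasoning
  shift : ∀ f → coeff (map (mulTerm (term 1ℚ 1 0 0)) f) (suc a) b c ≡ coeff f a b c
  shift []                     = refl
  shift (t@(term x i j k) ∷ f) = begin
    coeff (term (1ℚ * x) (suc i) j k ∷ map (mulTerm (term 1ℚ 1 0 0)) f) (suc a) b c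
      ≡⟨ coeff-∷ (term (1ℚ * x) (suc i) j k) _ (suc a) b c ⟩
    termCoeff (term (1ℚ * x) i j k) a b c + coeff (map (mulTerm (term 1ℚ 1 0 0)) f) (suc a) b c
      ≡⟨ cong₂ _+_ (trans (termCoeff-scale 1ℚ x i j k a b c) (ℚP.*-identityˡ (termCoeff t a b c))) (shift f) ⟩
    termCoeff t a b c + coeff f a b c
      ≡⟨ coeff-∷ t f a b c ⟨
    coeff (t ∷ f) a b c ∎

termCoeffs : Poly → Coef
termCoeffs f a b c = foldr (λ t s → termCoeff t a b c + s) 0ℚ f

coeff≡termCoeffs : ∀ f a b c → coeff f a b c ≡ termCoeffs f a b c
coeff≡termCoeffs []      a b c = refl
coeff≡termCoeffs (t ∷ f) a b c =
  trans (coeff-∷ t f a b c) (cong (λ s → termCoeff t a b c + s) (coeff≡termCoeffs f a b c))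

termCoeff-weightP : ∀ x w i j k a b c →
  termCoeff (term (x * ι i * w) (suc (i ∸ 1)) j k) a b c ≡ ι a * w * termCoeff (term x i j k) a b c
termCoeff-weightP x w i j k a b c = begin
  δ (suc (i ∸ 1)) a * (δ j b * (δ k c * (x * ι i * w))) ≡⟨ gather (δ (suc (i ∸ 1)) a) (δ j b) (δ k c) x (ι i) w ⟩
  δ (suc (i ∸ 1)) a * ι i * (w * (δ j b * (δ k c * x))) ≡⟨ cong (_* (w * (δ j b * (δ k c * x)))) (δ-pred-weight i a) ⟩
  δ i a * ι a * (w * (δ j b * (δ k c * x)))             ≡⟨ scatter (δ i a) (δ j b) (δ k c) x (ι a) w ⟩
  ι a * w * termCoeff (term x i j k) a b c              ∎
  where
  open ≡-Reasoning
  gather : ∀ D B C x I w → D * (B * (C * (x * I * w))) ≡ D * I * (w * (B * (C * x)))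
  gather = RingSolver.solve-∀ ℚ-ring
  scatter : ∀ D B C x I w → D * I * (w * (B * (C * x))) ≡ I * w * (D * (B * (C * x)))
  scatter = RingSolver.solve-∀ ℚ-ring

termCoeff-weightQ : ∀ x w i j k a b c →
  termCoeff (term (x * ι j * w) i (suc (j ∸ 1)) k) a b c ≡ ι b * w * termCoeff (term x i j k) a b c
termCoeff-weightQ x w i j k a b c = begin
  δ i a * (δ (suc (j ∸ 1)) b * (δ k c * (x * ι j * w))) ≡⟨ gather (δ i a) (δ (suc (j ∸ 1)) b) (δ k c) x (ι j) w ⟩
  δ (suc (j ∸ 1)) b * ι j * (w * (δ i a * (δ k c * x))) ≡⟨ cong (_* (w * (δ i a * (δ k c * x)))) (δ-pred-weight j b) ⟩
  δ j b * ι b * (w * (δ i a * (δ k c * x)))             ≡⟨ scatter (δ i a) (δ j b) (δ k c) x (ι b) w ⟩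
  ι b * w * termCoeff (term x i j k) a b c              ∎
  where
  open ≡-Reasoning
  gather : ∀ A D C x I w → A * (D * (C * (x * I * w))) ≡ D * I * (w * (A * (C * x)))
  gather = RingSolver.solve-∀ ℚ-ring
  scatter : ∀ A D C x I w → D * I * (w * (A * (C * x))) ≡ I * w * (A * (D * (C * x)))
  scatter = RingSolver.solve-∀ ℚ-ring

termCoeff-weightR : ∀ x w i j k a b c →
  termCoeff (term (x * ι k * w) i j (suc (k ∸ 1))) a b c ≡ ι c * w * termCoeff (term x i j k) a b c
termCoeff-weightR x w i j k a b c = begin
  δ i a * (δ j b * (δ (suc (k ∸ 1)) c * (x * ι k * w))) ≡⟨ gather (δ i a) (δ j b) (δ (suc (k ∸ 1)) c) x (ι k) w ⟩
  δ (suc (k ∸ 1)) c * ι k * (w * (δ i a * (δ j b * x))) ≡⟨ cong (_* (w * (δ i a * (δ j b * x)))) (δ-pred-weight k c) ⟩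
  δ k c * ι c * (w * (δ i a * (δ j b * x)))             ≡⟨ scatter (δ i a) (δ j b) (δ k c) x (ι c) w ⟩
  ι c * w * termCoeff (term x i j k) a b c              ∎
  where
  open ≡-Reasoning
  gather : ∀ A B D x I w → A * (B * (D * (x * I * w))) ≡ D * I * (w * (A * (B * x)))
  gather = RingSolver.solve-∀ ℚ-ring
  scatter : ∀ A B D x I w → D * I * (w * (A * (B * x))) ≡ I * w * (A * (B * (D * x)))
  scatter = RingSolver.solve-∀ ℚ-ring

-- DCoeff (coeff f) a b c is the coefficient of P^(a+1) Q^b R^c in D f.  The parts P²/12,
-- PQ/3, PR/2 of D P, D Q, D R raise the power of P and give dFactor; lowerP, lowerQ, lowerR
-- are the contributions of the remaining parts -Q/12, -R/3, -Q²/2.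
lowerP lowerQ lowerR : Coef → ℕ → ℕ → ℕ → ℚ
lowerP C a zero    c = 0ℚ
lowerP C a (suc b) c = ι (suc (suc a)) * (+ 1 / 12) * C (suc (suc a)) b c
lowerQ C a b zero    = 0ℚ
lowerQ C a b (suc c) = ι (suc b) * (+ 1 / 3) * C (suc a) (suc b) c
lowerR C a zero          c = 0ℚ
lowerR C a (suc zero)    c = 0ℚ
lowerR C a (suc (suc b)) c = ι (suc c) * (+ 1 / 2) * C (suc a) b (suc c)

dFactor : ℕ → ℕ → ℕ → ℚ
dFactor a b c = ι a * (+ 1 / 12) + ι b * (+ 1 / 3) + ι c * (+ 1 / 2)

DCoeff : Coef → Coef
DCoeff C a b c = dFactor a b c * C a b c - lowerP C a b c - lowerQ C a b c - lowerR C a b c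

-- The six terms of DTerm (term x i j k), with their exponents exactly as mulTerm produces them.
raiseP : ∀ x w i j k a b c →
  termCoeff (term (x * ι i * w) (i ∸ 1 ℕ.+ 2) (j ℕ.+ 0) (k ℕ.+ 0)) (suc a) b c ≡ ι a * w * termCoeff (term x i j k) a b c
raiseP x w i j k a b c rewrite ℕP.+-comm (i ∸ 1) 2 | ℕP.+-identityʳ j | ℕP.+-identityʳ k =
  termCoeff-weightP x w i j k a b c

raiseQ : ∀ x w i j k a b c →
  termCoeff (term (x * ι j * w) (i ℕ.+ 1) (j ∸ 1 ℕ.+ 1) (k ℕ.+ 0)) (suc a) b c ≡ ι b * w * termCoeff (term x i j k) a b c
raiseQ x w i j k a b c rewrite ℕP.+-comm i 1 | ℕP.+-comm (j ∸ 1) 1 | ℕP.+-identityʳ k =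
  termCoeff-weightQ x w i j k a b c

raiseR : ∀ x w i j k a b c →
  termCoeff (term (x * ι k * w) (i ℕ.+ 1) (j ℕ.+ 0) (k ∸ 1 ℕ.+ 1)) (suc a) b c ≡ ι c * w * termCoeff (term x i j k) a b c
raiseR x w i j k a b c rewrite ℕP.+-comm i 1 | ℕP.+-identityʳ j | ℕP.+-comm (k ∸ 1) 1 =
  termCoeff-weightR x w i j k a b c

lowerP-term : ∀ x i j k a b c →
  termCoeff (term (x * ι i * - (+ 1 / 12)) (i ∸ 1 ℕ.+ 0) (j ℕ.+ 1) (k ℕ.+ 0)) (suc a) b c
    ≡ - lowerP (termCoeff (term x i j k)) a b c
lowerP-term x i j k a zero c rewrite ℕP.+-comm j 1 =
  x*[0*y]≡0 (δ (i ∸ 1 ℕ.+ 0) (suc a)) (δ (k ℕ.+ 0) c * (x * ι i * - (+ 1 / 12)))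
lowerP-term x i j k a (suc b) c rewrite ℕP.+-identityʳ (i ∸ 1) | ℕP.+-comm j 1 | ℕP.+-identityʳ k =
  trans (termCoeff-weightP x (- (+ 1 / 12)) i j k (suc (suc a)) b c)
        (x*[-y]*z≡-[x*y*z] (ι (suc (suc a))) (+ 1 / 12) (termCoeff (term x i j k) (suc (suc a)) b c))

lowerQ-term : ∀ x i j k a b c →
  termCoeff (term (x * ι j * - (+ 1 / 3)) (i ℕ.+ 0) (j ∸ 1 ℕ.+ 0) (k ℕ.+ 1)) (suc a) b c
    ≡ - lowerQ (termCoeff (term x i j k)) a b c
lowerQ-term x i j k a b zero rewrite ℕP.+-comm k 1 =
  trans (cong (δ (i ℕ.+ 0) (suc a) *_) (x*[0*y]≡0 (δ (j ∸ 1 ℕ.+ 0) b) (x * ι j * - (+ 1 / 3))))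
        (ℚP.*-zeroʳ (δ (i ℕ.+ 0) (suc a)))
lowerQ-term x i j k a b (suc c) rewrite ℕP.+-identityʳ i | ℕP.+-identityʳ (j ∸ 1) | ℕP.+-comm k 1 =
  trans (termCoeff-weightQ x (- (+ 1 / 3)) i j k (suc a) (suc b) c)
        (x*[-y]*z≡-[x*y*z] (ι (suc b)) (+ 1 / 3) (termCoeff (term x i j k) (suc a) (suc b) c))

lowerR-term : ∀ x i j k a b c →
  termCoeff (term (x * ι k * - (+ 1 / 2)) (i ℕ.+ 0) (j ℕ.+ 2) (k ∸ 1 ℕ.+ 0)) (suc a) b c
    ≡ - lowerR (termCoeff (term x i j k)) a b c
lowerR-term x i j k a zero          c rewrite ℕP.+-comm j 2 =
  x*[0*y]≡0 (δ (i ℕ.+ 0) (suc a)) (δ (k ∸ 1 ℕ.+ 0) c * (x * ι k * - (+ 1 / 2)))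
lowerR-term x i j k a (suc zero)    c rewrite ℕP.+-comm j 2 =
  x*[0*y]≡0 (δ (i ℕ.+ 0) (suc a)) (δ (k ∸ 1 ℕ.+ 0) c * (x * ι k * - (+ 1 / 2)))
lowerR-term x i j k a (suc (suc b)) c rewrite ℕP.+-identityʳ i | ℕP.+-comm j 2 | ℕP.+-identityʳ (k ∸ 1) =
  trans (termCoeff-weightR x (- (+ 1 / 2)) i j k (suc a) b (suc c))
        (x*[-y]*z≡-[x*y*z] (ι (suc c)) (+ 1 / 2) (termCoeff (term x i j k) (suc a) b (suc c)))

coeff-DTerm : ∀ x i j k a b c → coeff (DTerm (term x i j k)) (suc a) b c ≡ DCoeff (termCoeff (term x i j k)) a b c
coeff-DTerm x i j k a b c =
  trans (coeff≡termCoeffs (DTerm (term x i j k)) (suc a) b c)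
    (trans (cong₂ _+_ (raiseP x (+ 1 / 12) i j k a b c) (cong₂ _+_ (lowerP-term x i j k a b c)
           (cong₂ _+_ (raiseQ x (+ 1 / 3) i j k a b c) (cong₂ _+_ (lowerQ-term x i j k a b c)
           (cong₂ _+_ (raiseR x (+ 1 / 2) i j k a b c) (cong₂ _+_ (lowerR-term x i j k a b c) refl))))))
      (collect (ι a) (ι b) (ι c) (termCoeff (term x i j k) a b c) _ _ _))
  where
  collect : ∀ A B C T LP LQ LR →
    A * (+ 1 / 12) * T + (- LP + (B * (+ 1 / 3) * T + (- LQ + (C * (+ 1 / 2) * T + (- LR + 0ℚ)))))
      ≡ (A * (+ 1 / 12) + B * (+ 1 / 3) + C * (+ 1 / 2)) * T - LP - LQ - LR
  collect = RingSolver.solve-∀ ℚ-ring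

module _ {C C₁ C₂ : Coef} (C≡C₁+C₂ : ∀ a b c → C a b c ≡ C₁ a b c + C₂ a b c) where

  lowerP-+ : ∀ a b c → lowerP C a b c ≡ lowerP C₁ a b c + lowerP C₂ a b c
  lowerP-+ a zero    c = refl
  lowerP-+ a (suc b) c rewrite C≡C₁+C₂ (suc (suc a)) b c =
    ℚP.*-distribˡ-+ (ι (suc (suc a)) * (+ 1 / 12)) (C₁ (suc (suc a)) b c) (C₂ (suc (suc a)) b c)

  lowerQ-+ : ∀ a b c → lowerQ C a b c ≡ lowerQ C₁ a b c + lowerQ C₂ a b c
  lowerQ-+ a b zero    = refl
  lowerQ-+ a b (suc c) rewrite C≡C₁+C₂ (suc a) (suc b) c =
    ℚP.*-distribˡ-+ (ι (suc b) * (+ 1 / 3)) (C₁ (suc a) (suc b) c) (C₂ (suc a) (suc b) c)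

  lowerR-+ : ∀ a b c → lowerR C a b c ≡ lowerR C₁ a b c + lowerR C₂ a b c
  lowerR-+ a zero          c = refl
  lowerR-+ a (suc zero)    c = refl
  lowerR-+ a (suc (suc b)) c rewrite C≡C₁+C₂ (suc a) b (suc c) =
    ℚP.*-distribˡ-+ (ι (suc c) * (+ 1 / 2)) (C₁ (suc a) b (suc c)) (C₂ (suc a) b (suc c))

  DCoeff-+ : ∀ a b c → DCoeff C a b c ≡ DCoeff C₁ a b c + DCoeff C₂ a b c
  DCoeff-+ a b c rewrite C≡C₁+C₂ a b c | lowerP-+ a b c | lowerQ-+ a b c | lowerR-+ a b c =
    distribute (dFactor a b c) (C₁ a b c) (C₂ a b c) _ _ _ _ _ _
    where
    distribute : ∀ F X Y P P′ Q Q′ R R′ →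
      F * (X + Y) - (P + P′) - (Q + Q′) - (R + R′) ≡ (F * X - P - Q - R) + (F * Y - P′ - Q′ - R′)
    distribute = RingSolver.solve-∀ ℚ-ring

VanishesAbove : Coef → ℕ → Set
VanishesAbove C r = ∀ i j k → r < i → C i j k ≡ 0ℚ

module _ {C : Coef} {r a : ℕ} (C-vanishes : VanishesAbove C r) (r≤a : r ≤ a) where

  lowerP-vanishes : ∀ b c → lowerP C a b c ≡ 0ℚ
  lowerP-vanishes zero    c = refl
  lowerP-vanishes (suc b) c rewrite C-vanishes (suc (suc a)) b c (s≤s (ℕP.m≤n⇒m≤1+n r≤a)) =
    ℚP.*-zeroʳ (ι (suc (suc a)) * (+ 1 / 12))

  lowerQ-vanishes : ∀ b c → lowerQ C a b c ≡ 0ℚ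
  lowerQ-vanishes b zero    = refl
  lowerQ-vanishes b (suc c) rewrite C-vanishes (suc a) (suc b) c (s≤s r≤a) =
    ℚP.*-zeroʳ (ι (suc b) * (+ 1 / 3))

  lowerR-vanishes : ∀ b c → lowerR C a b c ≡ 0ℚ
  lowerR-vanishes zero          c = refl
  lowerR-vanishes (suc zero)    c = refl
  lowerR-vanishes (suc (suc b)) c rewrite C-vanishes (suc a) b (suc c) (s≤s r≤a) =
    ℚP.*-zeroʳ (ι (suc c) * (+ 1 / 2))

  DCoeff-top : ∀ b c → DCoeff C a b c ≡ dFactor a b c * C a b c
  DCoeff-top b c rewrite lowerP-vanishes b c | lowerQ-vanishes b c | lowerR-vanishes b c =
    minus-zeros (dFactor a b c * C a b c)
    where
    minus-zeros : ∀ X → X - 0ℚ - 0ℚ - 0ℚ ≡ X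
    minus-zeros = RingSolver.solve-∀ ℚ-ring

coeff-D : ∀ f a b c → coeff (D f) (suc a) b c ≡ DCoeff (coeff f) a b c
coeff-D []                     a b c =
  sym (trans (DCoeff-top {r = 0} {a = a} (λ _ _ _ _ → refl) z≤n b c) (ℚP.*-zeroʳ (dFactor a b c)))
coeff-D (t@(term x i j k) ∷ f) a b c = begin
  coeff (DTerm t ++ D f) (suc a) b c                    ≡⟨ coeff-++ (DTerm t) (D f) (suc a) b c ⟩
  coeff (DTerm t) (suc a) b c + coeff (D f) (suc a) b c ≡⟨ cong₂ _+_ (coeff-DTerm x i j k a b c) (coeff-D f a b c) ⟩
  DCoeff (termCoeff t) a b c + DCoeff (coeff f) a b c   ≡⟨ DCoeff-+ (coeff-∷ t f) a b c ⟨
  DCoeff (coeff (t ∷ f)) a b c                          ∎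
  where open ≡-Reasoning

dhatFactor : ℕ → ℕ → ℕ → ℚ
dhatFactor a b c = dFactor a b c - + 1 / 24

coeff-Dhat-top : ∀ f {r a} → VanishesAbove (coeff f) r → r ≤ a →
  ∀ b c → coeff (Dhat f) (suc a) b c ≡ dhatFactor a b c * coeff f a b c
coeff-Dhat-top f {r} {a} f-vanishes r≤a b c = begin
  coeff (D f ++ scale (- 1ℚ) (scale (+ 1 / 24) (P ⊗ f))) (suc a) b c
    ≡⟨ coeff-++ (D f) _ (suc a) b c ⟩
  coeff (D f) (suc a) b c + coeff (scale (- 1ℚ) (scale (+ 1 / 24) (P ⊗ f))) (suc a) b c
    ≡⟨ cong₂ _+_ (trans (coeff-D f a b c) (DCoeff-top f-vanishes r≤a b c)) correction ⟩
  dFactor a b c * coeff f a b c + - 1ℚ * (+ 1 / 24 * coeff f a b c)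
    ≡⟨ combine (dFactor a b c) (coeff f a b c) ⟩
  dhatFactor a b c * coeff f a b c ∎
  where
  open ≡-Reasoning
  correction : coeff (scale (- 1ℚ) (scale (+ 1 / 24) (P ⊗ f))) (suc a) b c ≡ - 1ℚ * (+ 1 / 24 * coeff f a b c)
  correction = trans (coeff-scale (- 1ℚ) (scale (+ 1 / 24) (P ⊗ f)) (suc a) b c)
    (cong (- 1ℚ *_) (trans (coeff-scale (+ 1 / 24) (P ⊗ f) (suc a) b c) (cong (+ 1 / 24 *_) (coeff-P⊗ f a b c))))
  combine : ∀ F X → F * X + - 1ℚ * (+ 1 / 24 * X) ≡ (F - + 1 / 24) * X
  combine = RingSolver.solve-∀ ℚ-ring

dhatFactor*24 : ∀ a b c → dhatFactor a b c * ι 24 ≡ ι (2 ℕ.* (a ℕ.+ b ℕ.* 4 ℕ.+ c ℕ.* 6)) - 1ℚ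
dhatFactor*24 a b c = begin
  dhatFactor a b c * ι 24                     ≡⟨ clear-denominators (ι a) (ι b) (ι c) ⟩
  ι 2 * (ι a + ι b * ι 4 + ι c * ι 6) - 1ℚ    ≡⟨ cong (_- 1ℚ) ι-expand ⟨
  ι (2 ℕ.* (a ℕ.+ b ℕ.* 4 ℕ.+ c ℕ.* 6)) - 1ℚ ∎
  where
  open ≡-Reasoning
  clear-denominators : ∀ A B C →
    (A * (+ 1 / 12) + B * (+ 1 / 3) + C * (+ 1 / 2) - + 1 / 24) * ι 24 ≡ ι 2 * (A + B * ι 4 + C * ι 6) - 1ℚ
  clear-denominators = RingSolver.solve-∀ ℚ-ring
  ι-expand : ι (2 ℕ.* (a ℕ.+ b ℕ.* 4 ℕ.+ c ℕ.* 6)) ≡ ι 2 * (ι a + ι b * ι 4 + ι c * ι 6)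
  ι-expand = trans (ι-homo-* 2 (a ℕ.+ b ℕ.* 4 ℕ.+ c ℕ.* 6)) (cong (ι 2 *_) (trans (ι-homo-+ (a ℕ.+ b ℕ.* 4) (c ℕ.* 6))
    (cong₂ _+_ (trans (ι-homo-+ a (b ℕ.* 4)) (cong (_+_ (ι a)) (ι-homo-* b 4))) (ι-homo-* c 6))))

dhatFactor≢0 : ∀ a b c → dhatFactor a b c ≢ 0ℚ
dhatFactor≢0 a b c dhatFactor≡0 = ℕP.even≢odd (a ℕ.+ b ℕ.* 4 ℕ.+ c ℕ.* 6) 0 (ι-injective ι[2m]≡ι1)
  where
  ι[2m]≡ι1 : ι (2 ℕ.* (a ℕ.+ b ℕ.* 4 ℕ.+ c ℕ.* 6)) ≡ ι 1
  ι[2m]≡ι1 = begin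
    ι (2 ℕ.* (a ℕ.+ b ℕ.* 4 ℕ.+ c ℕ.* 6))              ≡⟨ add-sub (ι (2 ℕ.* (a ℕ.+ b ℕ.* 4 ℕ.+ c ℕ.* 6))) ⟩
    (ι (2 ℕ.* (a ℕ.+ b ℕ.* 4 ℕ.+ c ℕ.* 6)) - 1ℚ) + 1ℚ ≡⟨ cong (_+ 1ℚ) (dhatFactor*24 a b c) ⟨
    dhatFactor a b c * ι 24 + 1ℚ                       ≡⟨ cong (λ F → F * ι 24 + 1ℚ) dhatFactor≡0 ⟩
    ι 1                                                ∎
    where
    open ≡-Reasoning
    add-sub : ∀ X → X ≡ (X - 1ℚ) + 1ℚ
    add-sub = RingSolver.solve-∀ ℚ-ring

lemma3p1 : (f : Poly) (r : ℕ) → Depth f r → Depth (Dhat f) (suc r)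
lemma3p1 f r ((j , k , f[r,j,k]≢0) , f-vanishes) = (j , k , Dhat-top≢0) , Dhat-vanishes
  where
  Dhat-top≢0 : coeff (Dhat f) (suc r) j k ≢ 0ℚ
  Dhat-top≢0 Dhat-top≡0 = f[r,j,k]≢0 (w≢0∧w*x≡0⇒x≡0 (dhatFactor≢0 r j k)
    (trans (sym (coeff-Dhat-top f f-vanishes ℕP.≤-refl j k)) Dhat-top≡0))
  Dhat-vanishes : VanishesAbove (coeff (Dhat f)) (suc r)
  Dhat-vanishes (suc a) b c (s≤s r<a) = begin
    coeff (Dhat f) (suc a) b c       ≡⟨ coeff-Dhat-top f f-vanishes (ℕP.<⇒≤ r<a) b c ⟩
    dhatFactor a b c * coeff f a b c ≡⟨ cong (dhatFactor a b c *_) (f-vanishes a b c r<a) ⟩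
    dhatFactor a b c * 0ℚ            ≡⟨ ℚP.*-zeroʳ (dhatFactor a b c) ⟩
    0ℚ                               ∎
    where open ≡-Reasoning
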